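{- A modal Nelson lattice $\mathbf{N}=\langle\mathbf{A},\blacksquare,\Diamond_N\rangle$ is a modal $\phi$-regular Nelson lattice if and only if its associated modal Heyting algebra $\mathbf{M}_\mathbf{N}=\langle\mathbf{H}_\mathbf{A},\square,\Diamond\rangle$ (so that $\mathbf{N}$ is isomorphic to a subalgebra of $\mathbf{N}(\mathbf{M}_\mathbf{N})$) is crisp-witnessed and the Heyting algebra $\mathbf{H}_\mathbf{A}$ satisfies the Stone identity $-x\vee --x=\top$.
   Context: A Nelson lattice is an involutive residuated lattice $\langle A,\wedge,\vee,*,\Rightarrow,\top,\bot\rangle$ ($\sim a=a\Rightarrow\bot$, $\sim\sim a=a$, $a^2=a*a$) satisfying $((a^2\Rightarrow b)\wedge((\sim b)^2\Rightarrow\sim a))\Rightarrow(a\Rightarrow b)=\top$. A modal Nelson lattice is $\langle\mathbf{A},\blacksquare,\Diamond_N\rangle$ (here $\Diamond_N$ denotes the Nelson-level diamond, written as a black lozenge in the paper) with $\mathbf{A}$ a Nelson lattice such that for all $a,b$: $\Diamond_N a=\sim\blacksquare\sim a$; if $a^2=b^2$ then $(\blacksquare a)^2=(\blacksquare b)^2$ and $(\Diamond_N a)^2=(\Diamond_N b)^2$; and $(\blacksquare a\wedge\Diamond_N(\sim a^2\wedge b))^2=\bot$. Define $\nabla(x)=\sim(\sim x^2)^2$, $\Delta(x)=(\sim(\sim x)^2)^2$, $\phi(x)=\Delta(x)\wedge(\nabla(x\vee\sim x)\vee x)$. A Nelson lattice is $\phi$-regular if $\phi(x\vee y)=\phi(x)\vee\phi(y)$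 and $\phi(x\wedge y)=\phi(x)\wedge\phi(y)$; a modal Nelson lattice is modal $\phi$-regular if its Nelson reduct is $\phi$-regular and $\blacksquare\phi(x)=\phi(\blacksquare x)$ for all $x$. A modal Heyting algebra is $\langle\mathbf{H},\square,\Diamond\rangle$ with $\mathbf{H}$ a Heyting algebra ($-a=a\rightharpoonup\bot$) and unary $\square,\Diamond$ satisfying $\square a\wedge\Diamond(-a\wedge b)=\bot$; it is crisp-witnessed if $--\square x=\square--x$ and $--\Diamond x=\Diamond--x$ for all $x$. The associated modal Heyting algebra of $\mathbf{N}$ is (up to isomorphism) $\langle H^*,\square^*,\Diamond^*\rangle$ with $H^*=\{a\in A:a^2=a\}$, $a\vee^*b=(a\vee b)^2$, $a\wedge^*b=(a\wedge b)^2$, $a\rightharpoonup^*b=(a^2\Rightarrow b)^2$, $\square^*a=(\blacksquare a)^2$, $\Diamond^*a=(\Diamond_N a)^2$. $\mathbf{N}(\mathbf{M})$ is the twist structure on $\{(x,y)\in H\times H:x\wedge y=\bot\}$ with $(x,y)\vee(s,t)=(x\vee s,y\wedge t)$, $(x,y)\wedge(s,t)=(x\wedge s,y\vee t)$, $(x,y)*(s,t)=(x\wedge s,(x\rightharpoonup t)\wedge(s\rightharpoonup y))$, $(x,y)\Rightarrow(s,t)=((x\rightharpoonup s)\wedge(t\rightharpoonup y),x\wedge t)$, $\blacksquare(x,y)=(\square x,\Diamond y)$, $\Diamond_N(x,y)=(\Diamond x,\square y)$. -}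

module Defs where

open import Level using (Level; suc)
open import Relation.Binary.PropositionalEquality using (_≡_)
open import Algebra.Lattice.Structures using (IsLattice)
open import Algebra.Structures using (IsCommutativeMonoid)
open import Data.Product using (_×_)
open import Function.Bundles using (_⇔_)

record ResiduatedLattice (c : Level) : Set (suc c) where
  infixr 6 _∨_
  infixr 7 _∧_
  infixr 8 _*_
  infixr 5 _⇒_
  infix 4 _≤_
  field
    Carrier : Set c
    _∧_ _∨_ _*_ _⇒_ : Carrier → Carrier → Carrier
    ⊤ ⊥ : Carrier
    isLattice : IsLattice _≡_ _∨_ _∧_
    isCommutativeMonoid : IsCommutativeMonoid _≡_ _*_ ⊤

  _≤_ : Carrier → Carrier → Set c
  a ≤ b = a ∧ b ≡ a

  field
    ⊥-least : ∀ a → ⊥ ≤ a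
    ⊤-greatest : ∀ a → a ≤ ⊤
    residuation : ∀ a b d → (a * b ≤ d) ⇔ (a ≤ (b ⇒ d))

  ∼_ : Carrier → Carrier
  ∼ a = a ⇒ ⊥

  _² : Carrier → Carrier
  a ² = a * a

  infix 9 _²
  infix 10 ∼_

record InvolutiveResiduatedLattice (c : Level) : Set (suc c) where
  field
    residuatedLattice : ResiduatedLattice c
  open ResiduatedLattice residuatedLattice public
  field
    involutive : ∀ a → ∼ ∼ a ≡ a

record NelsonLattice (c : Level) : Set (suc c) where
  field
    involutiveResiduatedLattice : InvolutiveResiduatedLattice c
  open InvolutiveResiduatedLattice involutiveResiduatedLattice public
  field
    nelson : ∀ a b → (((a ² ⇒ b) ∧ ((∼ b) ² ⇒ ∼ a)) ⇒ (a ⇒ b)) ≡ ⊤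

record ModalNelsonLattice (c : Level) : Set (suc c) where
  field
    nelsonLattice : NelsonLattice c
  open NelsonLattice nelsonLattice public
  field
    ■ ◆ : Carrier → Carrier
    ◆-def : ∀ a → ◆ a ≡ ∼ ■ (∼ a)
    ■-cong² : ∀ a b → a ² ≡ b ² → (■ a) ² ≡ (■ b) ²
    ◆-cong² : ∀ a b → a ² ≡ b ² → (◆ a) ² ≡ (◆ b) ²
    ■◆-axiom : ∀ a b → (■ a ∧ ◆ ((∼ (a ²)) ∧ b)) ² ≡ ⊥

module _ {c : Level} (N : NelsonLattice c) where
  open NelsonLattice N

  ∇ : Carrier → Carrier
  ∇ x = ∼ ((∼ (x ²)) ²)

  Δ : Carrier → Carrier
  Δ x = (∼ ((∼ x) ²)) ²

  φ : Carrier → Carrier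
  φ x = Δ x ∧ (∇ (x ∨ ∼ x) ∨ x)

  φ-Regular : Set c
  φ-Regular = (∀ x y → φ (x ∨ y) ≡ φ x ∨ φ y) × (∀ x y → φ (x ∧ y) ≡ φ x ∧ φ y)

module _ {c : Level} (N : ModalNelsonLattice c) where
  open ModalNelsonLattice N

  ModalφRegular : Set c
  ModalφRegular = φ-Regular nelsonLattice × (∀ x → ■ (φ nelsonLattice x) ≡ φ nelsonLattice (■ x))

  -- The associated modal Heyting algebra M_N = ⟨H*, □*, ◇*⟩, presented (as in the
  -- paper) on H* = {a ∈ A : a² = a} with the operations restricted from A.
  IsH* : Carrier → Set c
  IsH* a = a ² ≡ a

  _∨*_ : Carrier → Carrier → Carrier
  a ∨* b = (a ∨ b) ²

  _⇀*_ : Carrier → Carrier → Carrier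
  a ⇀* b = (a ² ⇒ b) ²

  ⊥* ⊤* : Carrier
  ⊥* = ⊥
  ⊤* = ⊤

  -* : Carrier → Carrier
  -* a = a ⇀* ⊥*

  □* ◇* : Carrier → Carrier
  □* a = (■ a) ²
  ◇* a = (◆ a) ²

  AssocCrispWitnessed : Set c
  AssocCrispWitnessed =
    (∀ x → IsH* x → -* (-* (□* x)) ≡ □* (-* (-* x))) ×
    (∀ x → IsH* x → -* (-* (◇* x)) ≡ ◇* (-* (-* x)))

  AssocStone : Set c
  AssocStone = ∀ x → IsH* x → (-* x) ∨* (-* (-* x)) ≡ ⊤*

{-# OPTIONS --safe #-}

-- Every element a of a Nelson lattice is determined by the pair (a², (∼a)²) of elements of
-- the Heyting algebra H* of idempotents, on which * and ∨ are meet and join and −a = (∼a)²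
-- is the pseudocomplement.  Both components of φ a are double negations:
-- (φ a)² = −−(a²) and (∼ φ a)² = −−(−a).  Hence φ preserves ∧ and ∨ iff −− preserves
-- binary meets (always true) and binary joins of H*; the latter is equivalent to the Stone
-- identity, since −p ∨ −−p = ⊤ splits −(p * q) into −p ∨ −q, and conversely
-- ⊤ = −−(p ∨ −p) = −−p ∨ −p.  Likewise (■ a)² and (∼ ■ a)² = (◆ (−a))² depend only on
-- a² and −a, so ■ commutes with φ iff □ and ◇ commute with −− on H*.

module Submission where

open import Defs
open import Level using (Level)
open import Data.Product using (_×_; _,_)
open import Data.Product.Algebra using (×-comm)
open import Data.Product.Function.NonDependent.Propositional using (_×-⇔_)
open import Function.Bundles using (_⇔_; mk⇔; Equivalence)
open import Function.Construct.Composition using (_⇔-∘_)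
open import Function.Properties.Inverse using (↔⇒⇔)
open import Relation.Binary.PropositionalEquality
  using (_≡_; sym; trans; cong; cong₂; module ≡-Reasoning)
open import Algebra.Structures using (IsCommutativeMonoid)
open import Algebra.Bundles using (CommutativeSemigroup)
open import Algebra.Lattice.Bundles using (Lattice)
import Algebra.Lattice.Properties.Lattice as LatticeProperties
import Algebra.Properties.CommutativeSemigroup as CommutativeSemigroupProperties
import Relation.Binary.Lattice as OrderTheoretic
import Relation.Binary.Lattice.Properties.JoinSemilattice as JoinSemilatticeProperties
import Relation.Binary.Reasoning.PartialOrder as PartialOrderReasoning

module ResiduatedLatticeProperties {c : Level} (L : ResiduatedLattice c) where
  open ResiduatedLattice L hiding (_≤_)
  open IsCommutativeMonoid isCommutativeMonoid public
    using (assoc; comm; identityˡ; identityʳ)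

  lattice : Lattice c c
  lattice = record { isLattice = isLattice }

  open LatticeProperties lattice using (poset; ∨-∧-orderTheoreticLattice)
  open LatticeProperties lattice public using (∧-idem)

  -- This order is x ≡ x ∧ y, the symmetric form of the record's own a ∧ b ≡ a.
  open OrderTheoretic.Lattice ∨-∧-orderTheoreticLattice public
    using (_≤_; x∧y≤x; x∧y≤y; ∧-greatest; x≤x∨y; y≤x∨y; ∨-least)
    renaming (refl to ≤-refl; trans to ≤-trans; antisym to ≤-antisym; reflexive to ≤-reflexive)
  open JoinSemilatticeProperties (OrderTheoretic.Lattice.joinSemilattice ∨-∧-orderTheoreticLattice)
    public using (∨-comm; x≤y⇒x∨y≈y)
  module ≤-Reasoning = PartialOrderReasoning poset

  *-commutativeSemigroup : CommutativeSemigroup c c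
  *-commutativeSemigroup = record
    { isCommutativeSemigroup = IsCommutativeMonoid.isCommutativeSemigroup isCommutativeMonoid }

  open CommutativeSemigroupProperties *-commutativeSemigroup public
    using (interchange; xy∙z≈xz∙y; xy∙z≈x∙zy)

  ⊥-minimum : ∀ a → ⊥ ≤ a
  ⊥-minimum a = sym (⊥-least a)

  ⊤-maximum : ∀ a → a ≤ ⊤
  ⊤-maximum a = sym (⊤-greatest a)

  ⇒-intro : ∀ {a b d} → a * b ≤ d → a ≤ b ⇒ d
  ⇒-intro {a} {b} {d} ab≤d = sym (Equivalence.to (residuation a b d) (sym ab≤d))

  ⇒-elim : ∀ {a b d} → a ≤ b ⇒ d → a * b ≤ d
  ⇒-elim {a} {b} {d} a≤b⇒d = sym (Equivalence.from (residuation a b d) (sym a≤b⇒d))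

  modus-ponens : ∀ a b → (a ⇒ b) * a ≤ b
  modus-ponens a b = ⇒-elim ≤-refl

  *-monoˡ-≤ : ∀ {a b} d → a ≤ b → a * d ≤ b * d
  *-monoˡ-≤ d a≤b = ⇒-elim (≤-trans a≤b (⇒-intro ≤-refl))

  *-mono-≤ : ∀ {a b d e} → a ≤ b → d ≤ e → a * d ≤ b * e
  *-mono-≤ {a} {b} {d} {e} a≤b d≤e = begin
    a * d  ≤⟨ *-monoˡ-≤ d a≤b ⟩
    b * d  ≡⟨ comm b d ⟩
    d * b  ≤⟨ *-monoˡ-≤ b d≤e ⟩
    e * b  ≡⟨ comm e b ⟩
    b * e  ∎
    where open ≤-Reasoning

  x*y≤x : ∀ a b → a * b ≤ a
  x*y≤x a b = ≤-trans (*-mono-≤ ≤-refl (⊤-maximum b)) (≤-reflexive (identityʳ a))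

  x*y≤y : ∀ a b → a * b ≤ b
  x*y≤y a b = ≤-trans (≤-reflexive (comm a b)) (x*y≤x b a)

  ≤⇔⇒≡⊤ : ∀ {a b} → a ≤ b ⇔ (a ⇒ b ≡ ⊤)
  ≤⇔⇒≡⊤ {a} {b} = mk⇔
    (λ a≤b → ≤-antisym (⊤-maximum _) (⇒-intro (≤-trans (x*y≤y ⊤ a) a≤b)))
    (λ a⇒b≡⊤ → ≤-trans (≤-reflexive (sym (identityˡ a))) (⇒-elim (≤-reflexive (sym a⇒b≡⊤))))

  ⊤⇒x≡x : ∀ a → ⊤ ⇒ a ≡ a
  ⊤⇒x≡x a = ≤-antisym
    (≤-trans (≤-reflexive (sym (identityʳ (⊤ ⇒ a)))) (modus-ponens ⊤ a))
    (⇒-intro (≤-reflexive (identityʳ a)))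

  *-distribʳ-∨ : ∀ a x y → (x ∨ y) * a ≡ x * a ∨ y * a
  *-distribʳ-∨ a x y = ≤-antisym
    (⇒-elim (∨-least (⇒-intro (x≤x∨y _ _)) (⇒-intro (y≤x∨y _ _))))
    (∨-least (*-monoˡ-≤ a (x≤x∨y x y)) (*-monoˡ-≤ a (y≤x∨y x y)))

  *-distribˡ-∨ : ∀ a x y → a * (x ∨ y) ≡ a * x ∨ a * y
  *-distribˡ-∨ a x y = trans (comm a (x ∨ y))
    (trans (*-distribʳ-∨ a x y) (cong₂ _∨_ (comm x a) (comm y a)))

  x*∼x≤⊥ : ∀ a → a * ∼ a ≤ ⊥
  x*∼x≤⊥ a = ≤-trans (≤-reflexive (comm a (∼ a))) (modus-ponens a ⊥)

  ∼-swap : ∀ {a b} → a ≤ ∼ b → b ≤ ∼ a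
  ∼-swap {a} {b} a≤∼b = ⇒-intro (≤-trans (≤-reflexive (comm b a)) (⇒-elim a≤∼b))

  ∼-antitone : ∀ {a b} → a ≤ b → ∼ b ≤ ∼ a
  ∼-antitone {b = b} a≤b = ∼-swap (≤-trans a≤b (⇒-intro (x*∼x≤⊥ b)))

  ∼-distrib-∨ : ∀ a b → ∼ (a ∨ b) ≡ ∼ a ∧ ∼ b
  ∼-distrib-∨ a b = ≤-antisym
    (∧-greatest (∼-antitone (x≤x∨y a b)) (∼-antitone (y≤x∨y a b)))
    (∼-swap (∨-least (∼-swap (x∧y≤x _ _)) (∼-swap (x∧y≤y _ _))))

  ∼⊥≡⊤ : ∼ ⊥ ≡ ⊤
  ∼⊥≡⊤ = ≤-antisym (⊤-maximum _) (⇒-intro (x*y≤y ⊤ ⊥))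

  ²-mono-≤ : ∀ {a b} → a ≤ b → a ² ≤ b ²
  ²-mono-≤ a≤b = *-mono-≤ a≤b a≤b

  x²≤x : ∀ a → a ² ≤ a
  x²≤x a = x*y≤x a a

  Idempotent : Carrier → Set c
  Idempotent p = p ² ≡ p

  idempotent-* : ∀ {p q} → Idempotent p → Idempotent q → Idempotent (p * q)
  idempotent-* {p} {q} p²≡p q²≡q = trans (interchange p q p q) (cong₂ _*_ p²≡p q²≡q)

  idempotent-≤-* : ∀ {r a b} → Idempotent r → r ≤ a → r ≤ b → r ≤ a * b
  idempotent-≤-* r²≡r r≤a r≤b = ≤-trans (≤-reflexive (sym r²≡r)) (*-mono-≤ r≤a r≤b)

module InvolutiveResiduatedLatticeProperties {c : Level} (L : InvolutiveResiduatedLattice c) where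
  open InvolutiveResiduatedLattice L hiding (_≤_)
  open ResiduatedLatticeProperties residuatedLattice public

  ∼-distrib-∧ : ∀ a b → ∼ (a ∧ b) ≡ ∼ a ∨ ∼ b
  ∼-distrib-∧ a b = begin
    ∼ (a ∧ b)          ≡⟨ cong ∼_ (cong₂ _∧_ (involutive a) (involutive b)) ⟨
    ∼ (∼ ∼ a ∧ ∼ ∼ b)  ≡⟨ cong ∼_ (∼-distrib-∨ (∼ a) (∼ b)) ⟨
    ∼ ∼ (∼ a ∨ ∼ b)    ≡⟨ involutive (∼ a ∨ ∼ b) ⟩
    ∼ a ∨ ∼ b          ∎
    where open ≡-Reasoning

  ∼-⇒ : ∀ a b → ∼ (a ⇒ b) ≡ a * ∼ b
  ∼-⇒ a b = ≤-antisym
    (begin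
      ∼ (a ⇒ b)        ≤⟨ ∼-antitone ∼[x*∼y]≤x⇒y ⟩
      ∼ ∼ (a * ∼ b)    ≡⟨ involutive (a * ∼ b) ⟩
      a * ∼ b          ∎)
    (∼-swap (⇒-intro (begin
      (a ⇒ b) * (a * ∼ b)  ≡⟨ assoc (a ⇒ b) a (∼ b) ⟨
      ((a ⇒ b) * a) * ∼ b  ≤⟨ *-monoˡ-≤ (∼ b) (modus-ponens a b) ⟩
      b * ∼ b              ≤⟨ x*∼x≤⊥ b ⟩
      ⊥                    ∎)))
    where
    open ≤-Reasoning
    ∼[x*∼y]≤x⇒y : ∼ (a * ∼ b) ≤ a ⇒ b
    ∼[x*∼y]≤x⇒y = ⇒-intro (begin
      ∼ (a * ∼ b) * a            ≤⟨ ⇒-intro (begin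
        (∼ (a * ∼ b) * a) * ∼ b    ≡⟨ assoc _ a (∼ b) ⟩
        ∼ (a * ∼ b) * (a * ∼ b)    ≤⟨ modus-ponens _ ⊥ ⟩
        ⊥                          ∎) ⟩
      ∼ ∼ b                      ≡⟨ involutive b ⟩
      b                          ∎)

module NelsonLatticeProperties {c : Level} (N : NelsonLattice c) where
  open NelsonLattice N hiding (_≤_)
  open InvolutiveResiduatedLatticeProperties involutiveResiduatedLattice public

  nelson-≤ : ∀ {a b} → a ² ≤ b → (∼ b) ² ≤ ∼ a → a ≤ b
  nelson-≤ {a} {b} a²≤b ∼b²≤∼a = Equivalence.from ≤⇔⇒≡⊤ (begin
    a ⇒ b                                    ≡⟨ ⊤⇒x≡x (a ⇒ b) ⟨
    ⊤ ⇒ (a ⇒ b)                              ≡⟨ cong (_⇒ (a ⇒ b)) premises≡⊤ ⟨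
    ((a ² ⇒ b) ∧ ((∼ b) ² ⇒ ∼ a)) ⇒ (a ⇒ b)  ≡⟨ nelson a b ⟩
    ⊤                                        ∎)
    where
    open ≡-Reasoning
    premises≡⊤ : (a ² ⇒ b) ∧ ((∼ b) ² ⇒ ∼ a) ≡ ⊤
    premises≡⊤ = trans
      (cong₂ _∧_ (Equivalence.to ≤⇔⇒≡⊤ a²≤b) (Equivalence.to ≤⇔⇒≡⊤ ∼b²≤∼a)) (∧-idem ⊤)

  ∼⇒² : ∀ a b → (∼ (a ⇒ b)) ² ≡ a ² * (∼ b) ²
  ∼⇒² a b = trans (cong _² (∼-⇒ a b)) (interchange a (∼ b) a (∼ b))

  x*x²≡x² : ∀ a → a * a ² ≡ a ²
  x*x²≡x² a = ≤-antisym (x*y≤y a (a ²))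
    (⇒-elim (nelson-≤ (⇒-intro (≤-reflexive (comm (a ²) a))) (⇒-intro refutation)))
    where
    open ≤-Reasoning
    a³ : Carrier
    a³ = a * a ²
    refutation : (∼ (a ⇒ a³)) ² * a ≤ ⊥
    refutation = begin
      (∼ (a ⇒ a³)) ² * a      ≡⟨ cong (_* a) (∼⇒² a a³) ⟩
      (a ² * (∼ a³) ²) * a    ≡⟨ comm _ a ⟩
      a * (a ² * (∼ a³) ²)    ≡⟨ assoc a (a ²) _ ⟨
      a³ * (∼ a³) ²           ≤⟨ *-mono-≤ ≤-refl (x²≤x (∼ a³)) ⟩
      a³ * ∼ a³               ≤⟨ x*∼x≤⊥ a³ ⟩
      ⊥                       ∎

  ²-idempotent : ∀ a → Idempotent (a ²)
  ²-idempotent a = trans (assoc a a (a ²)) (trans (cong (a *_) (x*x²≡x² a)) (x*x²≡x² a))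

  ²-distrib-∧ : ∀ a b → (a ∧ b) ² ≡ a ² * b ²
  ²-distrib-∧ a b = ≤-antisym
    (idempotent-≤-* (²-idempotent (a ∧ b)) (²-mono-≤ (x∧y≤x a b)) (²-mono-≤ (x∧y≤y a b)))
    (≤-trans (≤-reflexive (sym (idempotent-* (²-idempotent a) (²-idempotent b))))
      (²-mono-≤ (∧-greatest (≤-trans (x*y≤x _ _) (x²≤x a)) (≤-trans (x*y≤y _ _) (x²≤x b)))))

  x*y≤x²∨y² : ∀ a b → a * b ≤ a ² ∨ b ²
  x*y≤x²∨y² a b = ⇒-elim (nelson-≤
    (⇒-intro (≤-trans (x*y≤x (a ²) b) (x≤x∨y _ _)))
    (≤-trans refutation (⊥-minimum (∼ a))))
    where
    open ≤-Reasoning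
    refutation : (∼ (b ⇒ a ² ∨ b ²)) ² ≤ ⊥
    refutation = begin
      (∼ (b ⇒ a ² ∨ b ²)) ²    ≡⟨ ∼⇒² b (a ² ∨ b ²) ⟩
      b ² * (∼ (a ² ∨ b ²)) ²  ≤⟨ *-mono-≤ ≤-refl (≤-trans (x²≤x _) (∼-antitone (y≤x∨y _ _))) ⟩
      b ² * ∼ (b ²)            ≤⟨ x*∼x≤⊥ (b ²) ⟩
      ⊥                        ∎

  ²-distrib-∨ : ∀ a b → (a ∨ b) ² ≡ a ² ∨ b ²
  ²-distrib-∨ a b = ≤-antisym
    (begin
      (a ∨ b) ²                          ≡⟨ *-distribʳ-∨ (a ∨ b) a b ⟩
      a * (a ∨ b) ∨ b * (a ∨ b)          ≡⟨ cong₂ _∨_ (*-distribˡ-∨ a a b) (*-distribˡ-∨ b a b) ⟩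
      (a ² ∨ a * b) ∨ (b * a ∨ b ²)      ≤⟨ ∨-least (∨-least (x≤x∨y _ _) (x*y≤x²∨y² a b))
                                                     (∨-least b*a≤a²∨b² (y≤x∨y _ _)) ⟩
      a ² ∨ b ²                          ∎)
    (∨-least (²-mono-≤ (x≤x∨y a b)) (²-mono-≤ (y≤x∨y a b)))
    where
    open ≤-Reasoning
    b*a≤a²∨b² : b * a ≤ a ² ∨ b ²
    b*a≤a²∨b² = ≤-trans (x*y≤x²∨y² b a) (≤-reflexive (∨-comm _ _))

  ²-∼²-reflects-≤ : ∀ {a b} → a ² ≤ b ² → (∼ b) ² ≤ (∼ a) ² → a ≤ b
  ²-∼²-reflects-≤ {a} {b} a²≤b² ∼b²≤∼a² =
    nelson-≤ (≤-trans a²≤b² (x²≤x b)) (≤-trans ∼b²≤∼a² (x²≤x (∼ a)))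

  ²-∼²-injective : ∀ {a b} → a ² ≡ b ² → (∼ a) ² ≡ (∼ b) ² → a ≡ b
  ²-∼²-injective a²≡b² ∼a²≡∼b² = ≤-antisym
    (²-∼²-reflects-≤ (≤-reflexive a²≡b²) (≤-reflexive (sym ∼a²≡∼b²)))
    (²-∼²-reflects-≤ (≤-reflexive (sym a²≡b²)) (≤-reflexive ∼a²≡∼b²))

  infix 10 −_
  −_ : Carrier → Carrier
  − a = (∼ a) ²

  −-idempotent : ∀ a → Idempotent (− a)
  −-idempotent a = ²-idempotent (∼ a)

  −∼x≡x² : ∀ a → − ∼ a ≡ a ²
  −∼x≡x² a = cong _² (involutive a)

  −-distrib-∨ : ∀ a b → − (a ∨ b) ≡ − a * − b
  −-distrib-∨ a b = trans (cong _² (∼-distrib-∨ a b)) (²-distrib-∧ (∼ a) (∼ b))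

  −-distrib-∧ : ∀ a b → − (a ∧ b) ≡ − a ∨ − b
  −-distrib-∧ a b = trans (cong _² (∼-distrib-∧ a b)) (²-distrib-∨ (∼ a) (∼ b))

  −-antitone : ∀ {a b} → a ≤ b → − b ≤ − a
  −-antitone a≤b = ²-mono-≤ (∼-antitone a≤b)

  −−-monotone : ∀ {a b} → a ≤ b → − − a ≤ − − b
  −−-monotone a≤b = −-antitone (−-antitone a≤b)

  x*−x≤⊥ : ∀ a → a * − a ≤ ⊥
  x*−x≤⊥ a = ≤-trans (*-mono-≤ ≤-refl (x²≤x (∼ a))) (x*∼x≤⊥ a)

  −x*x≤⊥ : ∀ a → − a * a ≤ ⊥
  −x*x≤⊥ a = ≤-trans (≤-reflexive (comm (− a) a)) (x*−x≤⊥ a)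

  −-intro : ∀ {r a} → Idempotent r → r * a ≤ ⊥ → r ≤ − a
  −-intro r²≡r ra≤⊥ = idempotent-≤-* r²≡r (⇒-intro ra≤⊥) (⇒-intro ra≤⊥)

  x≤−−x : ∀ {p} → Idempotent p → p ≤ − − p
  x≤−−x {p} p²≡p = −-intro p²≡p (x*−x≤⊥ p)

  −−−x≡−x : ∀ {p} → Idempotent p → − − − p ≡ − p
  −−−x≡−x {p} p²≡p = ≤-antisym (−-antitone (x≤−−x p²≡p)) (x≤−−x (−-idempotent p))

  −⊥≡⊤ : − ⊥ ≡ ⊤
  −⊥≡⊤ = trans (cong _² ∼⊥≡⊤) (identityˡ ⊤)

  −−[x∨−x]≡⊤ : ∀ a → − − (a ∨ − a) ≡ ⊤
  −−[x∨−x]≡⊤ a = trans (cong −_ −[x∨−x]≡⊥) −⊥≡⊤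
    where
    −[x∨−x]≡⊥ : − (a ∨ − a) ≡ ⊥
    −[x∨−x]≡⊥ = ≤-antisym
      (≤-trans (≤-reflexive (−-distrib-∨ a (− a))) (x*−x≤⊥ (− a))) (⊥-minimum _)

  −y*[x∨y]≡x : ∀ {p q} → Idempotent p → p * q ≤ ⊥ → − q * (p ∨ q) ≡ p
  −y*[x∨y]≡x {p} {q} p²≡p pq≤⊥ = ≤-antisym
    (begin
      − q * (p ∨ q)          ≡⟨ *-distribˡ-∨ (− q) p q ⟩
      − q * p ∨ − q * q      ≤⟨ ∨-least (x*y≤y (− q) p) (≤-trans (−x*x≤⊥ q) (⊥-minimum p)) ⟩
      p                      ∎)
    (idempotent-≤-* p²≡p (−-intro p²≡p pq≤⊥) (x≤x∨y p q))
    where open ≤-Reasoning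

  −[xy]*x≤−y : ∀ {p} q → Idempotent p → − (p * q) * p ≤ − q
  −[xy]*x≤−y {p} q p²≡p = −-intro (idempotent-* (−-idempotent _) p²≡p) (begin
    (− (p * q) * p) * q  ≡⟨ assoc _ p q ⟩
    − (p * q) * (p * q)  ≤⟨ −x*x≤⊥ (p * q) ⟩
    ⊥                    ∎)
    where open ≤-Reasoning

  −[xy]*−−y≤−x : ∀ {p} q → Idempotent p → − (p * q) * − − q ≤ − p
  −[xy]*−−y≤−x {p} q p²≡p = −-intro (idempotent-* (−-idempotent _) (−-idempotent _)) (begin
    (− (p * q) * − − q) * p  ≡⟨ xy∙z≈xz∙y _ _ p ⟩
    (− (p * q) * p) * − − q  ≤⟨ *-monoˡ-≤ (− − q) (−[xy]*x≤−y q p²≡p) ⟩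
    − q * − − q              ≤⟨ x*−x≤⊥ (− q) ⟩
    ⊥                        ∎)
    where open ≤-Reasoning

  −−-distrib-* : ∀ {p} q → Idempotent p → − − (p * q) ≡ − − p * − − q
  −−-distrib-* {p} q p²≡p = ≤-antisym
    (idempotent-≤-* (−-idempotent _) (−−-monotone (x*y≤x p q)) (−−-monotone (x*y≤y p q)))
    (−-intro (idempotent-* (−-idempotent _) (−-idempotent _)) (begin
      (− − p * − − q) * − (p * q)  ≡⟨ xy∙z≈x∙zy _ _ _ ⟩
      − − p * (− (p * q) * − − q)  ≤⟨ *-mono-≤ ≤-refl (−[xy]*−−y≤−x q p²≡p) ⟩
      − − p * − p                  ≤⟨ −x*x≤⊥ (− p) ⟩
      ⊥                            ∎))
    where open ≤-Reasoning

  Stone : Set c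
  Stone = ∀ {p} → Idempotent p → − p ∨ − − p ≡ ⊤

  stone⇒−[xy]≤−x∨−y : Stone → ∀ {p q} → Idempotent p → Idempotent q → − (p * q) ≤ − p ∨ − q
  stone⇒−[xy]≤−x∨−y stone {p} {q} p²≡p q²≡q = begin
    − (p * q)                                ≡⟨ identityʳ _ ⟨
    − (p * q) * ⊤                            ≡⟨ cong (− (p * q) *_) (stone p²≡p) ⟨
    − (p * q) * (− p ∨ − − p)                ≡⟨ *-distribˡ-∨ _ _ _ ⟩
    − (p * q) * − p ∨ − (p * q) * − − p      ≤⟨ ∨-least (≤-trans (x*y≤y _ _) (x≤x∨y _ _))
                                                        (≤-trans −[xy]*−−x≤−y (y≤x∨y _ _)) ⟩
    − p ∨ − q                                ∎
    where
    open ≤-Reasoning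
    −[xy]*−−x≤−y : − (p * q) * − − p ≤ − q
    −[xy]*−−x≤−y = ≤-trans (≤-reflexive (cong (λ x → − x * − − p) (comm p q))) (−[xy]*−−y≤−x p q²≡q)

  stone⇒−−-distrib-∨ : Stone → ∀ a b → − − (a ∨ b) ≡ − − a ∨ − − b
  stone⇒−−-distrib-∨ stone a b = ≤-antisym
    (begin
      − − (a ∨ b)    ≡⟨ cong −_ (−-distrib-∨ a b) ⟩
      − (− a * − b)  ≤⟨ stone⇒−[xy]≤−x∨−y stone (−-idempotent a) (−-idempotent b) ⟩
      − − a ∨ − − b  ∎)
    (∨-least (−−-monotone (x≤x∨y a b)) (−−-monotone (y≤x∨y a b)))
    where open ≤-Reasoning

  φ² : ∀ a → (φ N a) ² ≡ − − (a ²)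
  φ² a = begin
    (φ N a) ²                           ≡⟨ ²-distrib-∧ (Δ N a) _ ⟩
    (Δ N a) ² * (∇ N (a ∨ ∼ a) ∨ a) ²   ≡⟨ cong₂ _*_ (−-idempotent (− a)) (²-distrib-∨ _ a) ⟩
    − − a * (− − ((a ∨ ∼ a) ²) ∨ a ²)   ≡⟨ cong (λ x → − − a * (− − x ∨ a ²)) (²-distrib-∨ a (∼ a)) ⟩
    − − a * (− − a²∨−a ∨ a ²)           ≡⟨ cong (− − a *_) −−[a²∨−a]∨a²≡−−[a²∨−a] ⟩
    − − a * − − a²∨−a                   ≡⟨ cong (_* − − a²∨−a) (−−−x≡−x (−-idempotent a)) ⟨
    − − − − a * − − a²∨−a               ≡⟨ −−-distrib-* a²∨−a (−-idempotent (− a)) ⟨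
    − − (− − a * a²∨−a)                 ≡⟨ cong (λ x → − − x) −−a*[a²∨−a]≡a² ⟩
    − − (a ²)                           ∎
    where
    open ≡-Reasoning
    a²∨−a : Carrier
    a²∨−a = a ² ∨ − a
    −−[a²∨−a]∨a²≡−−[a²∨−a] : − − a²∨−a ∨ a ² ≡ − − a²∨−a
    −−[a²∨−a]∨a²≡−−[a²∨−a] = trans (∨-comm _ _)
      (x≤y⇒x∨y≈y (≤-trans (x≤−−x (²-idempotent a)) (−−-monotone (x≤x∨y _ _))))
    −−a*[a²∨−a]≡a² : − − a * a²∨−a ≡ a ²
    −−a*[a²∨−a]≡a² = −y*[x∨y]≡x (²-idempotent a) (≤-trans (*-monoˡ-≤ (− a) (x²≤x a)) (x*−x≤⊥ a))

  −φ : ∀ a → − φ N a ≡ − − − a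
  −φ a = trans (−-distrib-∧ (Δ N a) _)
    (trans (∨-comm _ _) (x≤y⇒x∨y≈y (≤-trans refuted (⊥-minimum _))))
    where
    open ≤-Reasoning
    −∇[x∨∼x] : − ∇ N (a ∨ ∼ a) ≡ − (a ² ∨ − a)
    −∇[x∨∼x] = trans (cong _² (involutive _))
      (trans (−-idempotent ((a ∨ ∼ a) ²)) (cong −_ (²-distrib-∨ a (∼ a))))
    refuted : − (∇ N (a ∨ ∼ a) ∨ a) ≤ ⊥
    refuted = begin
      − (∇ N (a ∨ ∼ a) ∨ a)    ≡⟨ −-distrib-∨ _ a ⟩
      − ∇ N (a ∨ ∼ a) * − a    ≡⟨ cong (_* − a) −∇[x∨∼x] ⟩
      − (a ² ∨ − a) * − a      ≤⟨ *-monoˡ-≤ (− a) (−-antitone (y≤x∨y _ _)) ⟩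
      − − a * − a              ≤⟨ −x*x≤⊥ (− a) ⟩
      ⊥                        ∎

  φ-homomorphic : (_∘_ _⊙_ _⊛_ : Carrier → Carrier → Carrier) →
    (∀ a b → (a ∘ b) ² ≡ (a ²) ⊙ (b ²)) →
    (∀ a b → − (a ∘ b) ≡ (− a) ⊛ (− b)) →
    (∀ a b → − − ((a ²) ⊙ (b ²)) ≡ (− − (a ²)) ⊙ (− − (b ²))) →
    (∀ a b → − − ((− a) ⊛ (− b)) ≡ (− − − a) ⊛ (− − − b)) →
    ∀ a b → φ N (a ∘ b) ≡ φ N a ∘ φ N b
  φ-homomorphic _∘_ _⊙_ _⊛_ ²-hom −-hom −−-hom-⊙ −−-hom-⊛ a b = ²-∼²-injective
    (begin
      (φ N (a ∘ b)) ²              ≡⟨ φ² (a ∘ b) ⟩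
      − − ((a ∘ b) ²)              ≡⟨ cong (λ x → − − x) (²-hom a b) ⟩
      − − ((a ²) ⊙ (b ²))          ≡⟨ −−-hom-⊙ a b ⟩
      (− − (a ²)) ⊙ (− − (b ²))    ≡⟨ cong₂ _⊙_ (φ² a) (φ² b) ⟨
      ((φ N a) ²) ⊙ ((φ N b) ²)    ≡⟨ ²-hom (φ N a) (φ N b) ⟨
      (φ N a ∘ φ N b) ²            ∎)
    (begin
      − φ N (a ∘ b)                ≡⟨ −φ (a ∘ b) ⟩
      − − − (a ∘ b)                ≡⟨ cong (λ x → − − x) (−-hom a b) ⟩
      − − ((− a) ⊛ (− b))          ≡⟨ −−-hom-⊛ a b ⟩
      (− − − a) ⊛ (− − − b)        ≡⟨ cong₂ _⊛_ (−φ a) (−φ b) ⟨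
      (− φ N a) ⊛ (− φ N b)        ≡⟨ −-hom (φ N a) (φ N b) ⟨
      − (φ N a ∘ φ N b)            ∎)
    where open ≡-Reasoning

  φ-regular⇒stone : φ-Regular N → Stone
  φ-regular⇒stone (φ-distrib-∨ , _) {p} p²≡p = begin
    − p ∨ − − p                   ≡⟨ ∨-comm _ _ ⟩
    − − p ∨ − p                   ≡⟨ cong₂ _∨_ (cong (λ x → − − x) p²≡p) (−−−x≡−x p²≡p) ⟨
    − − (p ²) ∨ − − (− p)         ≡⟨ cong₂ _∨_ (φ² p) (φ² (∼ p)) ⟨
    (φ N p) ² ∨ (φ N (∼ p)) ²     ≡⟨ ²-distrib-∨ _ _ ⟨
    (φ N p ∨ φ N (∼ p)) ²         ≡⟨ cong _² (φ-distrib-∨ p (∼ p)) ⟨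
    (φ N (p ∨ ∼ p)) ²             ≡⟨ φ² (p ∨ ∼ p) ⟩
    − − ((p ∨ ∼ p) ²)             ≡⟨ cong (λ x → − − x) (²-distrib-∨ p (∼ p)) ⟩
    − − (p ² ∨ − p)               ≡⟨ cong (λ x → − − (x ∨ − p)) p²≡p ⟩
    − − (p ∨ − p)                 ≡⟨ −−[x∨−x]≡⊤ p ⟩
    ⊤                             ∎
    where open ≡-Reasoning

  stone⇒φ-regular : Stone → φ-Regular N
  stone⇒φ-regular stone =
    φ-homomorphic _∨_ _∨_ _*_ ²-distrib-∨ −-distrib-∨
      (λ a b → stone⇒−−-distrib-∨ stone (a ²) (b ²))
      (λ a b → −−-distrib-* (− b) (−-idempotent a)) ,
    φ-homomorphic _∧_ _*_ _∨_ ²-distrib-∧ −-distrib-∧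
      (λ a b → −−-distrib-* (b ²) (²-idempotent a))
      (λ a b → stone⇒−−-distrib-∨ stone (− a) (− b))

  φ-regular⇔stone : φ-Regular N ⇔ Stone
  φ-regular⇔stone = mk⇔ φ-regular⇒stone stone⇒φ-regular

module ModalNelsonLatticeProperties {c : Level} (M : ModalNelsonLattice c) where
  open ModalNelsonLattice M hiding (_≤_)
  open NelsonLatticeProperties nelsonLattice

  [■x]²≡[■x²]² : ∀ a → (■ a) ² ≡ (■ (a ²)) ²
  [■x]²≡[■x²]² a = ■-cong² a (a ²) (sym (²-idempotent a))

  [◆x]²≡[◆x²]² : ∀ a → (◆ a) ² ≡ (◆ (a ²)) ²
  [◆x]²≡[◆x²]² a = ◆-cong² a (a ²) (sym (²-idempotent a))

  −■x≡[◆−x]² : ∀ a → − ■ a ≡ (◆ (− a)) ²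
  −■x≡[◆−x]² a = begin
    (∼ ■ a) ²          ≡⟨ cong (λ x → (∼ ■ x) ²) (involutive a) ⟨
    (∼ ■ (∼ ∼ a)) ²    ≡⟨ cong _² (◆-def (∼ a)) ⟨
    (◆ (∼ a)) ²        ≡⟨ [◆x]²≡[◆x²]² (∼ a) ⟩
    (◆ (− a)) ²        ∎
    where open ≡-Reasoning

  -*-*x≡−−x² : ∀ a → -* M (-* M a) ≡ − − (a ²)
  -*-*x≡−−x² a = cong −_ (−-idempotent (a ²))

  [■φx]²≡[■−−x²]² : ∀ x → (■ (φ nelsonLattice x)) ² ≡ (■ (− − (x ²))) ²
  [■φx]²≡[■−−x²]² x = trans ([■x]²≡[■x²]² _) (cong (λ y → (■ y) ²) (φ² x))

  −■φx≡[◆−−−x]² : ∀ x → − ■ (φ nelsonLattice x) ≡ (◆ (− − − x)) ²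
  −■φx≡[◆−−−x]² x = trans (−■x≡[◆−x]² _) (cong (λ y → (◆ y) ²) (−φ x))

  −φ■x≡−−[◆−x]² : ∀ x → − φ nelsonLattice (■ x) ≡ − − ((◆ (− x)) ²)
  −φ■x≡−−[◆−x]² x = trans (−φ (■ x)) (cong (λ y → − − y) (−■x≡[◆−x]² x))

  crisp-witnessed⇒■-commutes-with-φ :
    AssocCrispWitnessed M → ∀ x → ■ (φ nelsonLattice x) ≡ φ nelsonLattice (■ x)
  crisp-witnessed⇒■-commutes-with-φ (□-crisp , ◇-crisp) x = ²-∼²-injective
    (begin
      (■ (φ nelsonLattice x)) ²        ≡⟨ [■φx]²≡[■−−x²]² x ⟩
      (■ (− − (x ²))) ²                ≡⟨ cong (λ y → (■ (− − y)) ²) (²-idempotent x) ⟨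
      (■ (− − ((x ²) ²))) ²            ≡⟨ cong (λ y → (■ y) ²) (-*-*x≡−−x² (x ²)) ⟨
      □* M (-* M (-* M (x ²)))         ≡⟨ □-crisp (x ²) (²-idempotent x) ⟨
      -* M (-* M (□* M (x ²)))         ≡⟨ -*-*x≡−−x² _ ⟩
      − − ((□* M (x ²)) ²)             ≡⟨ cong (λ y → − − y) (²-idempotent (■ (x ²))) ⟩
      − − ((■ (x ²)) ²)                ≡⟨ cong (λ y → − − y) ([■x]²≡[■x²]² x) ⟨
      − − ((■ x) ²)                    ≡⟨ φ² (■ x) ⟨
      (φ nelsonLattice (■ x)) ²        ∎)
    (begin
      − ■ (φ nelsonLattice x)          ≡⟨ −■φx≡[◆−−−x]² x ⟩
      (◆ (− − (− x))) ²                ≡⟨ cong (λ y → (◆ (− − y)) ²) (−-idempotent x) ⟨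
      (◆ (− − ((− x) ²))) ²            ≡⟨ cong (λ y → (◆ y) ²) (-*-*x≡−−x² (− x)) ⟨
      ◇* M (-* M (-* M (− x)))         ≡⟨ ◇-crisp (− x) (−-idempotent x) ⟨
      -* M (-* M (◇* M (− x)))         ≡⟨ -*-*x≡−−x² _ ⟩
      − − ((◇* M (− x)) ²)             ≡⟨ cong (λ y → − − y) (²-idempotent (◆ (− x))) ⟩
      − − ((◆ (− x)) ²)                ≡⟨ −φ■x≡−−[◆−x]² x ⟨
      − φ nelsonLattice (■ x)          ∎)
    where open ≡-Reasoning

  ■-commutes-with-φ⇒crisp-witnessed :
    (∀ x → ■ (φ nelsonLattice x) ≡ φ nelsonLattice (■ x)) → AssocCrispWitnessed M
  ■-commutes-with-φ⇒crisp-witnessed commutes = □-crisp , ◇-crisp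
    where
    open ≡-Reasoning
    -- These hold for every p, not only for p ∈ H*.
    □-crisp : ∀ p → IsH* M p → -* M (-* M (□* M p)) ≡ □* M (-* M (-* M p))
    □-crisp p _ = begin
      -* M (-* M (□* M p))       ≡⟨ -*-*x≡−−x² _ ⟩
      − − ((□* M p) ²)           ≡⟨ cong (λ y → − − y) (²-idempotent (■ p)) ⟩
      − − ((■ p) ²)              ≡⟨ φ² (■ p) ⟨
      (φ nelsonLattice (■ p)) ²  ≡⟨ cong _² (commutes p) ⟨
      (■ (φ nelsonLattice p)) ²  ≡⟨ [■φx]²≡[■−−x²]² p ⟩
      (■ (− − (p ²))) ²          ≡⟨ cong (λ y → (■ y) ²) (-*-*x≡−−x² p) ⟨
      □* M (-* M (-* M p))       ∎
    ◇-crisp : ∀ q → IsH* M q → -* M (-* M (◇* M q)) ≡ ◇* M (-* M (-* M q))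
    ◇-crisp q _ = begin
      -* M (-* M (◇* M q))          ≡⟨ -*-*x≡−−x² _ ⟩
      − − ((◇* M q) ²)              ≡⟨ cong (λ y → − − y) (²-idempotent (◆ q)) ⟩
      − − ((◆ q) ²)                 ≡⟨ cong (λ y → − − y) ([◆x]²≡[◆x²]² q) ⟩
      − − ((◆ (q ²)) ²)             ≡⟨ cong (λ y → − − ((◆ y) ²)) (−∼x≡x² q) ⟨
      − − ((◆ (− ∼ q)) ²)           ≡⟨ −φ■x≡−−[◆−x]² (∼ q) ⟨
      − φ nelsonLattice (■ (∼ q))   ≡⟨ cong −_ (commutes (∼ q)) ⟨
      − ■ (φ nelsonLattice (∼ q))   ≡⟨ −■φx≡[◆−−−x]² (∼ q) ⟩
      (◆ (− − (− ∼ q))) ²           ≡⟨ cong (λ y → (◆ (− − y)) ²) (−∼x≡x² q) ⟩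
      (◆ (− − (q ²))) ²             ≡⟨ cong (λ y → (◆ y) ²) (-*-*x≡−−x² q) ⟨
      ◇* M (-* M (-* M q))          ∎

  ■-commutes-with-φ⇔crisp-witnessed :
    (∀ x → ■ (φ nelsonLattice x) ≡ φ nelsonLattice (■ x)) ⇔ AssocCrispWitnessed M
  ■-commutes-with-φ⇔crisp-witnessed =
    mk⇔ ■-commutes-with-φ⇒crisp-witnessed crisp-witnessed⇒■-commutes-with-φ

  stone⇔assocStone : Stone ⇔ AssocStone M
  stone⇔assocStone = mk⇔
    (λ stone _ p²≡p → trans (stone-form p²≡p) (stone p²≡p))
    (λ assocStone {p} p²≡p → trans (sym (stone-form p²≡p)) (assocStone p p²≡p))
    where
    open ≡-Reasoning
    stone-form : ∀ {p} → Idempotent p → _∨*_ M (-* M p) (-* M (-* M p)) ≡ − p ∨ − − p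
    stone-form {p} p²≡p = begin
      (-* M p ∨ -* M (-* M p)) ²    ≡⟨ cong₂ (λ x y → (− x ∨ y) ²) p²≡p
                                         (trans (-*-*x≡−−x² p) (cong (λ y → − − y) p²≡p)) ⟩
      (− p ∨ − − p) ²              ≡⟨ ²-distrib-∨ (− p) (− − p) ⟩
      (− p) ² ∨ (− − p) ²          ≡⟨ cong₂ _∨_ (−-idempotent p) (−-idempotent (− p)) ⟩
      − p ∨ − − p                  ∎

  φ-regular⇔assocStone : φ-Regular nelsonLattice ⇔ AssocStone M
  φ-regular⇔assocStone = stone⇔assocStone ⇔-∘ φ-regular⇔stone

theorem10 : {c : Level} (N : ModalNelsonLattice c) →
    ModalφRegular N ⇔ (AssocCrispWitnessed N × AssocStone N)
theorem10 N = ↔⇒⇔ (×-comm _ _) ⇔-∘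
  (φ-regular⇔assocStone ×-⇔ ■-commutes-with-φ⇔crisp-witnessed)
  where open ModalNelsonLatticeProperties N
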